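{- Let $n=p_1^{\alpha_1}p_2^{\alpha_2}\cdots p_k^{\alpha_k}$ be the prime power factorization of a composite integer $n$ (distinct primes $p_i$), with $\alpha_1\ge3$ if $k=1$, and suppose $n\notin\{p_1^3,p_1p_2\}$. Then $n/p_1,n/p_2,\dots,n/p_k$ are precisely the cut vertices of $\Upsilon_n$.
   Context: For an integer $n>1$, a proper divisor of $n$ is an integer $d$ with $1<d<n$ and $d\mid n$. The proper divisor graph $\Upsilon_n$ is the simple graph whose vertices are the proper divisors of $n$, two distinct vertices $u,v$ being adjacent iff $n\mid uv$ (it is connected for composite $n$). A cut vertex is a vertex whose removal increases the number of connected components. -}

module Defs where

open import Data.Nat using (ℕ; _<_; _*_)
open import Data.Nat.Divisibility using (_∣_)
open import Data.Product using (Σ; _×_)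
open import Relation.Nullary using (¬_)
open import Relation.Binary.PropositionalEquality using (_≢_)

ProperDivisor : ℕ → ℕ → Set
ProperDivisor n d = 1 < d × d < n × d ∣ n

-- Adjacency in the proper divisor graph Υ_n (simple graph: distinct vertices)
Adj : ℕ → ℕ → ℕ → Set
Adj n u v = u ≢ v × n ∣ u * v

data Path (V : ℕ → Set) (E : ℕ → ℕ → Set) : ℕ → ℕ → Set where
  here : ∀ {u} → V u → Path V E u u
  step : ∀ {u x w} → V u → E u x → Path V E x w → Path V E u w

Vert : ℕ → ℕ → Set
Vert n = ProperDivisor n

VertMinus : ℕ → ℕ → ℕ → Set
VertMinus n v d = ProperDivisor n d × d ≢ v

-- v is a cut vertex of Υ_n: removing v increases the number of connected
-- components, i.e. some two vertices u, w (both ≠ v) lying in the same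
-- component of Υ_n lie in different components of Υ_n - v.
CutVertex : ℕ → ℕ → Set
CutVertex n v =
  ProperDivisor n v ×
  Σ ℕ λ u → Σ ℕ λ w →
    VertMinus n v u × VertMinus n v w ×
    Path (Vert n) (Adj n) u w ×
    ¬ Path (VertMinus n v) (Adj n) u w

-- Every proper divisor u of n is adjacent (or equal) to n/q for any prime q ∣ u, and two
-- such maximal divisors n/q, n/r are adjacent. Hence removing v leaves a connected graph
-- unless v itself is some n/p; so only the n/p can be cut vertices. Conversely, the only
-- neighbour of the prime p is n/p, so removing n/p isolates p from any other neighbour
-- w of n/p; such a w = ap exists as soon as n/p = ab is composite and not p², which is
-- where n ∉ {p², p³, pq} is used.
module Submission where

open import Defs
open import Data.Nat.Base
open import Data.Nat.Properties
open import Data.Nat.Divisibility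
open import Data.Nat.Primality
open import Data.Nat.Primality.Factorisation using (factorise)
open import Data.Nat.ListAction using (product)
open import Data.List.Base using ([]; _∷_)
open import Data.List.Relation.Unary.All using (_∷_)
open import Data.Product using (Σ; ∃-syntax; _×_; _,_; proj₁)
open import Data.Sum using (_⊎_; inj₁; inj₂)
open import Data.Empty using (⊥-elim)
open import Function.Bundles using (_⇔_; mk⇔)
open import Relation.Nullary using (¬_; yes; no; contradiction)
open import Relation.Binary.PropositionalEquality

private
  variable
    n p q r h g u v w x y : ℕ

prime>1 : Prime p → 1 < p
prime>1 {p} pp = nonTrivial⇒n>1 p {{prime⇒nonTrivial pp}}

∃-prime-∣ : 1 < n → ∃[ p ] Prime p × p ∣ n
∃-prime-∣ {n} 1<n with factorise n {{>-nonZero (<-trans z<s 1<n)}}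
... | record { factors = [] ; isFactorisation = n≡1 } = contradiction (sym n≡1) (<⇒≢ 1<n)
... | record { factors = p ∷ ps ; isFactorisation = eq ; factorsPrime = pp ∷ _ } =
  p , pp , divides (product ps) (trans eq (*-comm p (product ps)))

_++ᴾ_ : ∀ {V E} → Path V E u v → Path V E v w → Path V E u w
here _       ++ᴾ π = π
step Vu e π′ ++ᴾ π = step Vu e (π′ ++ᴾ π)

Path-head : ∀ {V E} → Path V E u v → V u
Path-head (here Vu)     = Vu
Path-head (step Vu _ _) = Vu

Adj-path : ∀ {V} → V u → V w → (u ≢ w → n ∣ u * w) → Path V (Adj n) u w
Adj-path {u} {w} Vu Vw adj with u ≟ w
... | yes refl = here Vu
... | no u≢w   = step Vu (u≢w , adj u≢w) (here Vw)

cofactor>1 : Composite n → Prime q → h * q ≡ n → 1 < h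
cofactor>1 {h = 0}      c _  refl = contradiction (>-nonZero⁻¹ 0 {{composite⇒nonZero c}}) (λ ())
cofactor>1 {h = 1}      c pq refl = contradiction (subst Prime (sym (*-identityˡ _)) pq) (composite⇒¬prime c)
cofactor>1 {h = 2+ _}   _ _  _    = sz<ss

cofactor-proper : Composite n → Prime q → h * q ≡ n → ProperDivisor n h
cofactor-proper {q = q} {h} c pq hq≡n =
  1<h , subst (h <_) hq≡n (m<m*n h q {{>-nonZero (<-trans z<s 1<h)}} (prime>1 pq)) ,
  divides q (trans (sym hq≡n) (*-comm h q))
  where 1<h = cofactor>1 c pq hq≡n

∣⇒∣-times-cofactor : q ∣ u → h * q ≡ n → n ∣ u * h
∣⇒∣-times-cofactor {u = u} {h} q∣u hq≡n = subst₂ _∣_ hq≡n (*-comm h u) (*-monoʳ-∣ h q∣u)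

prime-∣-other-cofactor : Prime q → Prime r → h * q ≡ n → g * r ≡ n → h ≢ g → r ∣ h
prime-∣-other-cofactor {q} {r} {h} {n} {g} pq pr hq≡n gr≡n h≢g
  with euclidsLemma h q pr (subst (r ∣_) (sym hq≡n) (divides g (sym gr≡n)))
... | inj₁ r∣h = r∣h
... | inj₂ r∣q with prime⇒irreducible pq r∣q
...   | inj₁ refl = contradiction (prime>1 pr) (<-irrefl refl)
...   | inj₂ refl = contradiction (*-cancelʳ-≡ h g q {{prime⇒nonZero pq}} (trans hq≡n (sym gr≡n))) h≢g

connected-via-cofactors : (V : ℕ → Set) → (∀ {d} → V d → ProperDivisor n d) →
  (∀ {q h} → Prime q → h * q ≡ n → V h) →
  V u → V w → Path V (Adj n) u w
connected-via-cofactors {n = n} {w = w} V V⊆Υ cofactor∈V Vu Vw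
  with V⊆Υ Vu | V⊆Υ Vw
... | 1<u , _ , u∣n | 1<w , _ , w∣n
  with ∃-prime-∣ 1<u | ∃-prime-∣ 1<w
... | q , pq , q∣u | r , pr , r∣w
  with ∣-trans q∣u u∣n | ∣-trans r∣w w∣n
... | divides h n≡hq | divides g n≡gr =
  Adj-path Vu Vh (λ _ → ∣⇒∣-times-cofactor q∣u (sym n≡hq)) ++ᴾ
  (Adj-path Vh Vg (λ h≢g → ∣⇒∣-times-cofactor
     (prime-∣-other-cofactor pq pr (sym n≡hq) (sym n≡gr) h≢g) (sym n≡gr)) ++ᴾ
   Adj-path Vg Vw (λ _ → subst (n ∣_) (*-comm w g) (∣⇒∣-times-cofactor r∣w (sym n≡gr))))
  where
  Vh : V h
  Vh = cofactor∈V pq (sym n≡hq)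
  Vg : V g
  Vg = cofactor∈V pr (sym n≡gr)

minus-connected : Composite n → x * v ≡ n → ¬ Prime x →
  VertMinus n v u → VertMinus n v w → Path (VertMinus n v) (Adj n) u w
minus-connected {n} {x} {v} c xv≡n ¬px = connected-via-cofactors (VertMinus n v) proj₁ cofactor∈V
  where
  cofactor∈V : ∀ {q h} → Prime q → h * q ≡ n → VertMinus n v h
  cofactor∈V {q} {h} pq hq≡n = cofactor-proper c pq hq≡n , h≢v
    where
    h≢v : h ≢ v
    h≢v refl = ¬px (subst Prime (sym x≡q) pq)
      where
      x≡q : x ≡ q
      x≡q = *-cancelʳ-≡ x q h {{>-nonZero (<-trans z<s (cofactor>1 c pq hq≡n))}}
              (trans xv≡n (trans (sym hq≡n) (*-comm h q)))

cut-vertex⇒cofactor : Composite n → CutVertex n v → Σ ℕ λ p → Prime p × p ∣ n × v * p ≡ n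
cut-vertex⇒cofactor {n} {v} c ((_ , _ , divides x n≡xv) , _ , _ , Vu , Vw , _ , ¬path) with prime? x
... | yes px = x , px , divides v (trans n≡xv (*-comm x v)) , trans (*-comm v x) (sym n≡xv)
... | no ¬px = contradiction (minus-connected c (sym n≡xv) ¬px Vu Vw) ¬path

neighbour-of-prime : Prime p → v * p ≡ n → ProperDivisor n y → n ∣ p * y → y ≡ v
neighbour-of-prime {v = zero} _ refl (_ , () , _) _
neighbour-of-prime {p = p} {v = v@(suc v-1)} {y = y} pp refl (_ , y<n , y∣n) n∣py
  with *-cancelʳ-∣ {v} {y} p {{prime⇒nonZero pp}} (subst (v * p ∣_) (*-comm p y) n∣py)
... | divides-refl x with prime⇒irreducible pp (*-cancelʳ-∣ {x} {p} v (subst (x * v ∣_) (*-comm v p) y∣n))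
...   | inj₁ refl = *-identityˡ v
...   | inj₂ refl = contradiction (*-comm p v) (<⇒≢ y<n)

prime-isolated-in-minus : Prime p → v * p ≡ n → Path (VertMinus n v) (Adj n) p w → w ≡ p
prime-isolated-in-minus pp vp≡n (here _) = refl
prime-isolated-in-minus pp vp≡n (step _ (_ , n∣py) π) with Path-head π
... | Vy , y≢v = contradiction (neighbour-of-prime pp vp≡n Vy n∣py) y≢v

factor-times-prime : Prime p → 1 < x → 1 < y → y * x ≡ v →
  ProperDivisor (v * p) (x * p) × p ∣ x * p × x * p ≢ p
factor-times-prime {p} {x} {y} pp 1<x 1<y refl =
  (<-≤-trans 1<x (m≤m*n x p {{prime⇒nonZero pp}}) ,
   *-monoˡ-< p {{prime⇒nonZero pp}} (subst (x <_) (*-comm x y) (m<m*n x y {{x≢0}} 1<y)) ,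
   *-monoˡ-∣ p (divides y refl)) ,
  n∣m*n x ,
  λ xp≡p → <⇒≢ 1<x (sym (*-cancelʳ-≡ x 1 p {{prime⇒nonZero pp}} (trans xp≡p (sym (*-identityˡ p)))))
  where x≢0 = >-nonZero (<-trans z<s 1<x)

∃-multiple-of-prime : Prime p → 1 < x → 1 < y → y * x ≡ v → v ≢ p * p →
  Σ ℕ λ w → (ProperDivisor (v * p) w × p ∣ w × w ≢ p) × w ≢ v
∃-multiple-of-prime {p} {x} {y} pp 1<x 1<y refl v≢pp with x * p ≟ y * x
... | no xp≢v = x * p , factor-times-prime pp 1<x 1<y refl , xp≢v
... | yes xp≡v with y * p ≟ y * x
...   | no yp≢v = y * p , factor-times-prime pp 1<y 1<x (*-comm x y) , yp≢v
...   | yes yp≡v = ⊥-elim (v≢pp (cong₂ _*_ y≡p x≡p))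
  where
  y≡p : y ≡ p
  y≡p = *-cancelˡ-≡ y p x {{>-nonZero (<-trans z<s 1<x)}} (trans (*-comm x y) (sym xp≡v))
  x≡p : x ≡ p
  x≡p = *-cancelˡ-≡ x p y {{>-nonZero (<-trans z<s 1<y)}} (sym yp≡v)

cofactor⇒cut-vertex : Prime p → v * p ≡ n → Composite v → v ≢ p * p → CutVertex n v
cofactor⇒cut-vertex {p} {v} pp refl cv@(composite {a} a<v a∣v@(divides b v≡ba)) v≢pp
  with ∃-multiple-of-prime pp (nonTrivial⇒n>1 a) (quotient>1 a∣v a<v) (sym v≡ba) v≢pp
... | w , (Vw , p∣w , w≢p) , w≢v =
  Vv , p , w , (Vp , p≢v) , (Vw , w≢v) ,
  step Vp (p≢v , subst (v * p ∣_) (*-comm v p) ∣-refl)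
    (step Vv ((λ v≡w → w≢v (sym v≡w)) , *-monoʳ-∣ v p∣w) (here Vw)) ,
  λ π → w≢p (prime-isolated-in-minus pp refl π)
  where
  instance _ = composite⇒nonZero cv
  instance _ = prime⇒nonZero pp
  1<v : 1 < v
  1<v = nonTrivial⇒n>1 v {{composite⇒nonTrivial cv}}
  Vv : ProperDivisor (v * p) v
  Vv = 1<v , m<m*n v p (prime>1 pp) , m∣m*n p
  Vp : ProperDivisor (v * p) p
  Vp = prime>1 pp , subst (p <_) (*-comm p v) (m<m*n p v 1<v) , n∣m*n v
  p≢v : p ≢ v
  p≢v refl = composite⇒¬prime cv pp

proposition2p14 : (n : ℕ) → Composite n →
    ¬ (Σ ℕ λ p → Prime p × (n ≡ p ^ 2 ⊎ n ≡ p ^ 3)) →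
    ¬ (Σ ℕ λ p → Σ ℕ λ q → Prime p × Prime q × p ≢ q × n ≡ p * q) →
    (v : ℕ) → CutVertex n v ⇔ (Σ ℕ λ p → Prime p × p ∣ n × v * p ≡ n)
proposition2p14 n c ¬p²∨p³ ¬pq v = mk⇔ (cut-vertex⇒cofactor c) from-cofactor
  where
  from-cofactor : (Σ ℕ λ p → Prime p × p ∣ n × v * p ≡ n) → CutVertex n v
  from-cofactor (p , pp , _ , vp≡n) = cofactor⇒cut-vertex pp vp≡n composite-v v≢p²
    where
    n≡p² : v ≡ p → n ≡ p ^ 2
    n≡p² refl = trans (sym vp≡n) (cong (v *_) (sym (*-identityʳ v)))
    v≢p² : v ≢ p * p
    v≢p² refl = ¬p²∨p³ (p , pp , inj₂ (begin
      n                 ≡⟨ vp≡n ⟨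
      p * p * p         ≡⟨ *-assoc p p p ⟩
      p * (p * p)       ≡⟨ cong (λ m → p * (p * m)) (*-identityʳ p) ⟨
      p * (p * (p * 1)) ∎))
      where open ≡-Reasoning
    ¬prime-v : ¬ Prime v
    ¬prime-v pv with v ≟ p
    ... | yes v≡p = ¬p²∨p³ (p , pp , inj₁ (n≡p² v≡p))
    ... | no v≢p  = ¬pq (v , p , pv , pp , v≢p , sym vp≡n)
    composite-v : Composite v
    composite-v = ¬prime⇒composite {{n>1⇒nonTrivial (cofactor>1 c pp vp≡n)}} ¬prime-v
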